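{- Let $T$ be a finite rooted ordered tree with root $r$, where $r$ has at least one child. Let $T_2$ be the subtree of $T$ rooted at the rightmost child of $r$ (that child and all its descendants), and let $T_1=T\setminus T_2$ (the tree obtained by deleting $T_2$). Then $T^*=T_1^*\curvearrowright(r\rightarrow T_2)^*$.
   Context: For a tree $A$ and a node $r$, $r\rightarrow A$ is the tree obtained by adding $r$ as a new root whose only child is the root of $A$. Tree joining: for rooted ordered trees $S_1,S_2$ with roots $r_1,r_2$ such that the rightmost child of $r_2$ exists and is a leaf, $S_1\curvearrowright S_2$ is the tree obtained from $S_2$ by inserting the children of $r_1$ (with their subtrees, in their order) as the children of the rightmost child of $r_2$. Here $T_1^*$ and $(r\rightarrow T_2)^*$ both have root $r$, and the joined tree has the vertex set of $T$. Dual tree: for a tree $T$ with root $r$, $T^*$ has the same vertex set and root $r$; with $rmc_T(u)$ the rightmost child and $ils_T(u)$ the immediate left sibling of $u$ in $T$: (1a) $r$ has no parent in $T^*$; (1b) if $v=rmc_T(r)$ then $v$ is the rightmost child of $r$ in $T^*$; (2) if $v=rmc_T(u)$ with $u\ne r$, then $v$ is the immediate left sibling of $u$ in $T^*$; (3) if $v=ils_T(u)$, then $v$ is the rightmost child of $u$ in $T^*$. -}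

module Defs where

open import Data.List using (List; []; _∷_; _++_; [_]; concatMap)
open import Data.Maybe using (Maybe; just; nothing)
open import Data.Product using (_×_; _,_)
open import Relation.Binary.PropositionalEquality using (_≡_; refl)

-- Finite rooted ordered tree with vertices labelled by elements of A:
-- a root label together with the ordered (left-to-right) list of the
-- subtrees rooted at its children.
data Tree (A : Set) : Set where
  node : A → List (Tree A) → Tree A

module _ {A : Set} where

  vertices : Tree A → List A
  verticesF : List (Tree A) → List A
  vertices (node a ts) = a ∷ verticesF ts
  verticesF [] = []
  verticesF (t ∷ ts) = vertices t ++ verticesF ts

  _⇒_ : A → Tree A → Tree A
  r ⇒ t = node r [ t ]

  -- Dual tree.
  -- dualF acc F : if F is the forest (left to right) of the left siblings
  -- of a vertex u in T (or the children of the root r), the list of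
  -- children (left to right) of u (resp. r) in T*.  Unfolding the rules
  -- (1b),(2),(3): the T*-children of u, from right to left, are
  -- ils(u), rmc(ils u), rmc(rmc(ils u)), ... ; for the root they are
  -- rmc(r), rmc(rmc r), ... .  Processing F left to right with
  -- accumulator acc = T*-children list for the prefix already seen:
  --   dual-children (F ++ [node w cs]) = dual-children cs ++ [node w (dual-children F)].
  dualF : List (Tree A) → List (Tree A) → List (Tree A)
  dualF acc [] = acc
  dualF acc (node w cs ∷ rest) = dualF (dualF [] cs ++ [ node w acc ]) rest

  infix 30 _*
  _* : Tree A → Tree A
  node r cs * = node r (dualF [] cs)

  unsnoc : List (Tree A) → Maybe (List (Tree A) × Tree A)
  unsnoc [] = nothing
  unsnoc (t ∷ []) = just ([] , t)
  unsnoc (t ∷ u ∷ ts) with unsnoc (u ∷ ts)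
  ... | nothing = nothing
  ... | just (init , l) = just (t ∷ init , l)

  infix 10 _↷_
  _↷_ : Tree A → Tree A → Maybe (Tree A)
  node r₁ cs₁ ↷ node r₂ cs₂ with unsnoc cs₂
  ... | nothing = nothing
  ... | just (ds , node v []) = just (node r₂ (ds ++ [ node v cs₁ ]))
  ... | just (ds , node v (_ ∷ _)) = nothing

private
  data V : Set where r a b : V
  ex1 : node r (node a [] ∷ node b [] ∷ []) * ≡ node r [ node b [ node a [] ] ]
  ex1 = refl
  ex2 : node r [ node a [ node b [] ] ] * ≡ node r (node b [] ∷ node a [] ∷ [])
  ex2 = refl

-- Both sides are computed by the same left-to-right fold dualF: the dual of
-- T = node r (cs ++ [ node v ds ]) first folds cs, producing the children of
-- r in T₁*, and then attaches them to v, which sits as the rightmost child of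
-- r behind the dual of ds.  In (r → T₂)* the vertex v sits in the same place
-- as a leaf, and joining hangs exactly those children of r in T₁* below it.
module Submission where

open import Defs
open import Data.List using (List; []; _∷_; _++_; [_])
open import Data.List.Relation.Unary.Unique.Propositional using (Unique)
open import Data.Maybe using (just)
open import Data.Product using (_,_)
open import Relation.Binary.PropositionalEquality using (_≡_; refl; cong; sym; module ≡-Reasoning)
open ≡-Reasoning

module _ {A : Set} where

  dualF-++ : (acc xs ys : List (Tree A)) →
             dualF acc (xs ++ ys) ≡ dualF (dualF acc xs) ys
  dualF-++ acc []               ys = refl
  dualF-++ acc (node w cs ∷ xs) ys = dualF-++ _ xs ys

  unsnoc-++ : (xs : List (Tree A)) (x : Tree A) → unsnoc (xs ++ [ x ]) ≡ just (xs , x)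
  unsnoc-++ []           x = refl
  unsnoc-++ (t ∷ [])     x = refl
  unsnoc-++ (t ∷ u ∷ ts) x rewrite unsnoc-++ (u ∷ ts) x = refl

  ↷-leaf : (r₁ r₂ v : A) (cs ds : List (Tree A)) →
           (node r₁ cs ↷ node r₂ (ds ++ [ node v [] ])) ≡ just (node r₂ (ds ++ [ node v cs ]))
  ↷-leaf r₁ r₂ v cs ds rewrite unsnoc-++ ds (node v []) = refl

  dual-snoc : (r v : A) (cs ds : List (Tree A)) →
              node r (cs ++ [ node v ds ]) * ≡ node r (dualF [] ds ++ [ node v (dualF [] cs) ])
  dual-snoc r v cs ds = cong (node r) (dualF-++ [] cs [ node v ds ])

lemma12 : {A : Set} (r : A) (cs : List (Tree A)) (t₂ : Tree A) →
    Unique (vertices (node r (cs ++ [ t₂ ]))) →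
    ((node r cs) * ↷ (r ⇒ t₂) *) ≡ just ((node r (cs ++ [ t₂ ])) *)
lemma12 r cs (node v ds) _ = begin
  ((node r cs) * ↷ (r ⇒ node v ds) *)                  ≡⟨⟩
  (node r cs * ↷ node r (dualF [] ds ++ [ node v [] ])) ≡⟨ ↷-leaf r r v (dualF [] cs) (dualF [] ds) ⟩
  just (node r (dualF [] ds ++ [ node v (dualF [] cs) ])) ≡⟨ cong just (sym (dual-snoc r v cs ds)) ⟩
  just (node r (cs ++ [ node v ds ]) *)                 ∎
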